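{- Let $n\ge 1$ and let $\pi=\pi_1\pi_2\ldots\pi_n\in\mathcal{DU}_n(4123)$. Write $\mathcal{A}(\pi)=\{a_0,a_1,\ldots,a_p\}$ with $p\ge 0$ and $0=a_0<a_1<\cdots<a_p$, and set $a_{p+1}=\pi_1$. Let $a,b\in[n+2]$ with $b<a$. If $\pi'=(a,b)\rightarrow\pi$ belongs to $\mathcal{DU}_{n+2}(4123)$, then $b\le \pi_1$ and there exists an integer $j$ with $0\le j\le p$ such that $a_{j+1}+2\ge a>b\ge a_j+1$.
   Context: For $[m]=\{1,\ldots,m\}$, a permutation $\pi=\pi_1\cdots\pi_m$ of $[m]$ is down-up alternating if $\pi_1>\pi_2<\pi_3>\pi_4<\cdots$. A permutation $\pi$ contains the pattern $\tau=\tau_1\cdots\tau_k$ if some subsequence $\pi_{i_1}\cdots\pi_{i_k}$ ($i_1<\cdots<i_k$) is order-isomorphic to $\tau$; otherwise it avoids $\tau$. $\mathcal{DU}_m(4123)$ denotes the set of $4123$-avoiding down-up alternating permutations of $[m]$. For a permutation $\pi$ of $[n]$, $\mathcal{A}(\pi)=\{0\}\cup\{k : \exists\, i<j \text{ with } \pi_i=k,\ \pi_j=k+1,\ \text{and } k\le \pi_1-2\}$. For $a,b\in[n+2]$ with $b<a$, $(a,b)\rightarrow\pi$ denotes the permutation $u=u_1\cdots u_{n+2}$ of $[n+2]$ with $u_1=a$, $u_2=b$, and $u_3\cdots u_{n+2}$ order-isomorphic to $\pi$; explicitly, for $i\ge 3$, $u_i=\pi_{i-2}$ if $\pi_{i-2}<b$,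 $u_i=\pi_{i-2}+1$ if $b\le\pi_{i-2}<a-1$, and $u_i=\pi_{i-2}+2$ if $\pi_{i-2}\ge a-1$. -}

module Defs where

open import Data.Nat using (ℕ; zero; suc; _+_; _∸_; _≤_; _<_; _<?_)
open import Data.Nat.Properties using ()
open import Data.Fin using (Fin; toℕ) renaming (zero to fzero; suc to fsuc)
open import Data.Fin as F using (_<_)
open import Data.Product using (_×_; ∃-syntax; Σ-syntax)
open import Data.Sum using (_⊎_)
open import Relation.Nullary using (¬_; yes; no)
open import Relation.Binary.PropositionalEquality using (_≡_)

-- A permutation of [m] = {1,…,m} is a function π : Fin m → ℕ
-- (position i, 0-based, holds π_{i+1}) that is injective with values in [m].
IsPerm : (m : ℕ) → (Fin m → ℕ) → Set
IsPerm m π = (∀ i → 1 ≤ π i × π i ≤ m) × (∀ i j → π i ≡ π j → i ≡ j)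

data Even : ℕ → Set where
  ev0  : Even 0
  ev2  : ∀ {k} → Even k → Even (suc (suc k))

-- Down-up: π₁ > π₂ < π₃ > π₄ < ⋯ .  With 0-based index k and k+1 < m:
-- k even ⇒ π k > π (k+1), k odd ⇒ π k < π (k+1).
DownUp : (m : ℕ) → (Fin m → ℕ) → Set
DownUp m π = ∀ (i j : Fin m) → toℕ j ≡ suc (toℕ i) →
  (Even (toℕ i) → π j Data.Nat.< π i) × (¬ Even (toℕ i) → π i Data.Nat.< π j)

Contains4123 : (m : ℕ) → (Fin m → ℕ) → Set
Contains4123 m π = ∃[ i₁ ] ∃[ i₂ ] ∃[ i₃ ] ∃[ i₄ ]
  ((i₁ F.< i₂) × (i₂ F.< i₃) × (i₃ F.< i₄) ×
   (π i₂ Data.Nat.< π i₃) × (π i₃ Data.Nat.< π i₄) × (π i₄ Data.Nat.< π i₁))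

DU4123 : (m : ℕ) → (Fin m → ℕ) → Set
DU4123 m π = IsPerm m π × DownUp m π × ¬ Contains4123 m π

InA : (n : ℕ) → (Fin (suc n) → ℕ) → ℕ → Set
InA n π k = (k ≡ 0) ⊎
  (∃[ i ] ∃[ j ] ((i F.< j) × (π i ≡ k) × (π j ≡ suc k) × (k + 2 ≤ π fzero)))

shiftVal : ℕ → ℕ → ℕ → ℕ
shiftVal a b v with v <? b
... | yes _ = v
... | no _ with v <? (a ∸ 1)
...   | yes _ = v + 1
...   | no _  = v + 2

-- (a,b) → π : the permutation u of [m+2] with u₁ = a, u₂ = b and
-- u₃⋯u_{m+2} order-isomorphic to π (explicit formula from the paper).
arrow : (m : ℕ) → ℕ → ℕ → (Fin m → ℕ) → Fin (suc (suc m)) → ℕ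
arrow m a b π fzero = a
arrow m a b π (fsuc fzero) = b
arrow m a b π (fsuc (fsuc k)) = shiftVal a b (π k)

-- Since π' is down-up, b = π'₂ < π'₃, and the entry π'₃ is only raised
-- above b when π₁ ≥ b.  The sets 𝒜(π) and 𝒜(π) ∪ {π₁} are decidable, so we
-- may take x = the largest element of 𝒜(π) below b and y = the least element
-- of 𝒜(π) ∪ {π₁} that is ≥ b (π₁ is one); no element of 𝒜(π) lies strictly
-- between them, and x + 1 ≤ b.  It remains to see a ≤ y + 2.  Otherwise y and
-- y + 1 both lie in the window [b, a-2] whose entries are shifted by exactly
-- one, and y occurs before y + 1 in π: for y ∈ 𝒜(π) by definition, for y = π₁
-- because y + 1 ≤ n + 1 is a value of the permutation π.  Then a, b, y+1, y+2
-- is a 4123 pattern in π', a contradiction.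
module Submission where

open import Defs
open import Data.Nat using (ℕ; suc; _+_; _≤_; _<_)
open import Data.Fin using (Fin) renaming (zero to fzero)
open import Data.Product using (_×_; ∃-syntax)
open import Data.Sum using (_⊎_)
open import Relation.Nullary using (¬_)
open import Relation.Binary.PropositionalEquality using (_≡_)

open import Data.Nat using (zero; _∸_; z≤n; s≤s; s≤s⁻¹; z<s; s<s; _≤?_; _<?_)
  renaming (_≟_ to _≟ℕ_)
open import Data.Nat.Properties
  using (≤-refl; <⇒≤; 1+n≢n; +-comm; +-suc; m∸n+n≡m; m≤n⇒m≤1+n; n<1+n;
         m≤n⇒m<n∨m≡n; <-≤-trans; <-asym; ≤⇒≯; <⇒≱; ≮⇒≥; ≰⇒>)
open import Data.Fin using (fromℕ<; punchOut) renaming (suc to fsuc)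
import Data.Fin as F
open import Data.Fin.Properties
  using (any?; fromℕ<-injective; punchOut-injective; <⇒notInjective)
  renaming (_<?_ to _<F?_)
open import Data.Product using (_,_; proj₁; proj₂; map₂)
open import Data.Sum using (inj₁; inj₂)
open import Data.Empty using (⊥; ⊥-elim)
open import Function.Definitions using (Injective)
open import Relation.Nullary using (yes; no; contradiction)
open import Relation.Nullary.Decidable using (_×-dec_; _⊎-dec_)
open import Relation.Unary using (Decidable)
open import Relation.Binary.PropositionalEquality using (refl; sym; trans; cong; subst; subst₂)

leastFrom : {P : ℕ → Set} → Decidable P → ∀ b k → P (k + b) →
  ∃[ y ] (b ≤ y × P y × (∀ z → b ≤ z → z < y → ¬ P z))
leastFrom P? b k pk with P? b
... | yes pb = b , ≤-refl , pb , λ z b≤z z<b _ → <⇒≱ z<b b≤z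
leastFrom P? b zero    pk | no ¬pb = contradiction pk ¬pb
leastFrom {P} P? b (suc k) pk | no ¬pb
  with y , b<y , py , noneBelow ← leastFrom P? (suc b) k (subst P (sym (+-suc k b)) pk)
  = y , <⇒≤ b<y , py , noneBelow′
  where
  noneBelow′ : ∀ z → b ≤ z → z < y → ¬ P z
  noneBelow′ z b≤z z<y with m≤n⇒m<n∨m≡n b≤z
  ... | inj₁ b<z  = noneBelow z b<z z<y
  ... | inj₂ refl = ¬pb

greatestUpTo : {P : ℕ → Set} → Decidable P → P 0 → ∀ c →
  ∃[ x ] (x ≤ c × P x × (∀ z → x < z → z ≤ c → ¬ P z))
greatestUpTo P? p0 c with P? c
... | yes pc = c , ≤-refl , pc , λ z c<z z≤c _ → <⇒≱ c<z z≤c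
greatestUpTo P? p0 zero    | no ¬p0 = contradiction p0 ¬p0
greatestUpTo {P} P? p0 (suc c) | no ¬pc
  with x , x≤c , px , noneAbove ← greatestUpTo P? p0 c
  = x , m≤n⇒m≤1+n x≤c , px , noneAbove′
  where
  noneAbove′ : ∀ z → x < z → z ≤ suc c → ¬ P z
  noneAbove′ z x<z z≤sc with m≤n⇒m<n∨m≡n z≤sc
  ... | inj₁ z<sc = noneAbove z x<z (s≤s⁻¹ z<sc)
  ... | inj₂ refl = ¬pc

gapAround : {P Q : ℕ → Set} → Decidable P → Decidable Q → (∀ {z} → P z → Q z) → P 0 →
  ∀ {b c} → 1 ≤ b → b ≤ c → Q c →
  ∃[ x ] ∃[ y ] (P x × Q y × x < b × b ≤ y × (∀ z → P z → x < z → ¬ (z < y)))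
gapAround {P} {Q} P? Q? P⊆Q p0 {suc b′} {c} _ b≤c qc
  with x , x≤b′ , px , noneAbove ← greatestUpTo P? p0 b′
     | y , b≤y , qy , noneBelow ← leastFrom Q? (suc b′) (c ∸ suc b′) (subst Q (sym (m∸n+n≡m b≤c)) qc)
  = x , y , px , qy , s≤s x≤b′ , b≤y , between
  where
  between : ∀ z → P z → x < z → ¬ (z < y)
  between z pz x<z z<y with z ≤? b′
  ... | yes z≤b′ = noneAbove z x<z z≤b′ pz
  ... | no z≰b′  = noneBelow z (≰⇒> z≰b′) z<y (P⊆Q pz)

-- An injective endofunction of Fin m is surjective: a missed value v would let
-- punchOut squeeze it injectively into Fin (m - 1).
injective⇒surjective : ∀ {m} {f : Fin m → Fin m} → Injective _≡_ _≡_ f → ∀ v → ∃[ i ] f i ≡ v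
injective⇒surjective {suc k} {f} f-inj v with any? (λ i → f i F.≟ v)
... | yes hit = hit
... | no miss = ⊥-elim (<⇒notInjective {f = squeeze} (n<1+n k) squeeze-injective)
  where
  missed : ∀ i → v ≡ f i → ⊥
  missed i v≡fi = miss (i , sym v≡fi)
  squeeze : Fin (suc k) → Fin k
  squeeze i = punchOut (missed i)
  squeeze-injective : Injective _≡_ _≡_ squeeze
  squeeze-injective {i} {j} e = f-inj (punchOut-injective (missed i) (missed j) e)

-- A value w ∈ [m] as the element w - 1 of Fin m.
index : ∀ {m w} → 1 ≤ w → w ≤ m → Fin m
index (s≤s z≤n) w≤m = fromℕ< w≤m

index-injective : ∀ {m w w′} (p : 1 ≤ w) (q : w ≤ m) (p′ : 1 ≤ w′) (q′ : w′ ≤ m) →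
  index p q ≡ index p′ q′ → w ≡ w′
index-injective (s≤s z≤n) q (s≤s z≤n) q′ e = cong suc (fromℕ<-injective _ _ q q′ e)

perm-surjective : ∀ {m} {π : Fin m → ℕ} → IsPerm m π → ∀ {v} → 1 ≤ v → v ≤ m → ∃[ i ] π i ≡ v
perm-surjective {π = π} (inRange , π-inj) 1≤v v≤m =
  map₂ (λ {i} → index-injective (proj₁ (inRange i)) (proj₂ (inRange i)) 1≤v v≤m)
       (injective⇒surjective π̂-injective (index 1≤v v≤m))
  where
  π̂ : Fin _ → Fin _
  π̂ i = index (proj₁ (inRange i)) (proj₂ (inRange i))
  π̂-injective : Injective _≡_ _≡_ π̂
  π̂-injective {i} {j} e =
    π-inj i j (index-injective (proj₁ (inRange i)) (proj₂ (inRange i))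
                               (proj₁ (inRange j)) (proj₂ (inRange j)) e)

-- Entries below b stay below b, so an entry shifted above b was already ≥ b.
shiftVal-large : ∀ a b v → b < shiftVal a b v → b ≤ v
shiftVal-large a b v b<v′ with v <? b
... | yes v<b = contradiction v<b (<-asym b<v′)
... | no v≮b  = ≮⇒≥ v≮b

shiftVal-window : ∀ {a b v} → b ≤ v → suc (suc v) ≤ a → shiftVal a b v ≡ suc v
shiftVal-window {a} {b} {v} b≤v v+2≤a with v <? b
... | yes v<b = contradiction v<b (≤⇒≯ b≤v)
... | no _ with v <? a ∸ 1
...   | yes _    = +-comm v 1
...   | no v≮a-1 = contradiction (below-a-1 v+2≤a) v≮a-1
  where
  below-a-1 : ∀ {c} → suc (suc v) ≤ c → suc v ≤ c ∸ 1
  below-a-1 (s≤s le) = le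

-- If b ≤ y, y + 3 ≤ a and the value y occurs before y + 1 in π, then in (a,b) → π
-- these entries become y + 1, y + 2 and together with a, b form a 4123 pattern.
consecutive⇒4123 : ∀ {m} (π : Fin m → ℕ) {a b y} {i j : Fin m} →
  b ≤ y → suc (suc (suc y)) ≤ a → i F.< j → π i ≡ y → π j ≡ suc y →
  Contains4123 (suc (suc m)) (arrow m a b π)
consecutive⇒4123 π {a} {b} {y} {i} {j} b≤y y+3≤a i<j πi≡y πj≡y+1 =
  fzero , fsuc fzero , fsuc (fsuc i) , fsuc (fsuc j) ,
  z<s , s<s z<s , s<s (s<s i<j) ,
  subst (b <_) (sym shift-i) (s≤s b≤y) ,
  subst₂ _<_ (sym shift-i) (sym shift-j) (n<1+n (suc y)) ,
  subst (_< a) (sym shift-j) y+3≤a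
  where
  shift-i : shiftVal a b (π i) ≡ suc y
  shift-i = trans (cong (shiftVal a b) πi≡y) (shiftVal-window b≤y (s≤s⁻¹ (m≤n⇒m≤1+n y+3≤a)))
  shift-j : shiftVal a b (π j) ≡ suc (suc y)
  shift-j = trans (cong (shiftVal a b) πj≡y+1) (shiftVal-window (m≤n⇒m≤1+n b≤y) y+3≤a)

InA? : ∀ n (π : Fin (suc n) → ℕ) → Decidable (InA n π)
InA? n π k = (k ≟ℕ 0) ⊎-dec any? (λ i → any? (λ j →
  (i <F? j) ×-dec (π i ≟ℕ k) ×-dec (π j ≟ℕ suc k) ×-dec (k + 2 ≤? π fzero)))

-- An element y ≥ b ≥ 1 of 𝒜(π) ∪ {π₁} with y + 3 ≤ a ≤ n + 3 yields a 4123 pattern in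
-- (a,b) → π: y ≠ 0, and y occurs before y + 1 in π.
farEndpoint⇒4123 : ∀ n (π : Fin (suc n) → ℕ) → IsPerm (suc n) π → ∀ {a b y} →
  1 ≤ b → a ≤ suc n + 2 → b ≤ y → suc (suc (suc y)) ≤ a → InA n π y ⊎ y ≡ π fzero →
  Contains4123 (suc (suc (suc n))) (arrow (suc n) a b π)
farEndpoint⇒4123 n π perm 1≤b a≤n+3 b≤y y+3≤a (inj₁ (inj₁ refl)) = contradiction (<-≤-trans 1≤b b≤y) λ ()
farEndpoint⇒4123 n π perm 1≤b a≤n+3 b≤y y+3≤a (inj₁ (inj₂ (i , j , i<j , πi , πj , _))) =
  consecutive⇒4123 π b≤y y+3≤a i<j πi πj
farEndpoint⇒4123 n π perm 1≤b a≤n+3 b≤π₁ π₁+3≤a (inj₂ refl)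
  with perm-surjective perm (s≤s z≤n) (s≤s (y+3≤n+3⇒y≤n (<-≤-trans π₁+3≤a a≤n+3)))
  where
  y+3≤n+3⇒y≤n : ∀ {y} → suc (suc (suc y)) ≤ suc n + 2 → y ≤ n
  y+3≤n+3⇒y≤n {y} le = s≤s⁻¹ (s≤s⁻¹ (s≤s⁻¹ (subst (suc (suc (suc y)) ≤_) (+-comm (suc n) 2) le)))
... | fzero  , π₁≡π₁+1 = contradiction (sym π₁≡π₁+1) 1+n≢n
... | fsuc j , πj≡π₁+1 = consecutive⇒4123 π b≤π₁ π₁+3≤a z<s refl πj≡π₁+1

-- In π' = (a,b) → π down-up, π'₂ = b < π'₃ = shiftVal a b π₁, which forces b ≤ π₁.
second⇒b≤π₁ : ∀ n (π : Fin (suc n) → ℕ) {a b} → DownUp (suc (suc (suc n))) (arrow (suc n) a b π) →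
  b ≤ π fzero
second⇒b≤π₁ n π {a} {b} downUp′ =
  shiftVal-large a b (π fzero) (proj₂ (downUp′ (fsuc fzero) (fsuc (fsuc fzero)) refl) λ ())

lemma2p3 : (n : ℕ) (π : Fin (suc n) → ℕ) → DU4123 (suc n) π →
    (a b : ℕ) → 1 ≤ b → b < a → a ≤ suc n + 2 →
    DU4123 (suc (suc (suc n))) (arrow (suc n) a b π) →
    (b ≤ π fzero) ×
    (∃[ x ] ∃[ y ] (InA n π x × (InA n π y ⊎ y ≡ π fzero) × x < y ×
      (∀ z → InA n π z → x < z → ¬ (z < y)) ×
      a ≤ y + 2 × suc x ≤ b))
lemma2p3 n π (perm , _) a b 1≤b _ a≤n+3 (_ , downUp′ , avoids′)
  with b≤π₁ ← second⇒b≤π₁ n π downUp′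
  with x , y , x∈𝒜 , y∈𝒜∪π₁ , x<b , b≤y , between
         ← gapAround (InA? n π) (λ z → InA? n π z ⊎-dec (z ≟ℕ π fzero)) inj₁ (inj₁ refl)
                     1≤b b≤π₁ (inj₂ refl)
  = b≤π₁ , x , y , x∈𝒜 , y∈𝒜∪π₁ , <-≤-trans x<b b≤y , between , a≤y+2 , x<b
  where
  -- otherwise y and y + 1 would give a 4123 pattern in π'
  a≤y+2 : a ≤ y + 2
  a≤y+2 with a ≤? y + 2
  ... | yes ok = ok
  ... | no a≰y+2 = ⊥-elim (avoids′ (farEndpoint⇒4123 n π perm 1≤b a≤n+3 b≤y
                                      (subst (_< a) (+-comm y 2) (≰⇒> a≰y+2)) y∈𝒜∪π₁))
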